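{- Let $k\geq 2$ be an integer. For any graph $G$ of order $n$ with $\delta(G)\geq k$, $$k\rho(G)\leq \gamma_{\times k}(G)\leq n-\rho(G).$$
   Context: All graphs are simple (finite). For $v\in V(G)$, $N(v)$ is the open neighbourhood and $N[v]=N(v)\cup\{v\}$ the closed neighbourhood; for $D\subseteq V(G)$, $\deg_D(v)=|N(v)\cap D|$. $\delta(G)$ is the minimum degree. A set $D\subseteq V(G)$ is a $k$-tuple dominating set of $G$ if $\deg_D(v)\geq k$ for every $v\in V(G)\setminus D$ and $\deg_D(v)\geq k-1$ for every $v\in D$; $\gamma_{\times k}(G)$ is the minimum cardinality of a $k$-tuple dominating set. A set $D\subseteq V(G)$ is a $2$-packing if $N[u]\cap N[v]=\emptyset$ for every pair of distinct $u,v\in D$; $\rho(G)$ is the maximum cardinality of a $2$-packing of $G$. -}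

module Defs where

open import Data.Nat using (ℕ; _≤_; _∸_)
open import Data.Fin using (Fin)
open import Data.Fin.Subset using (Subset; _∈_; _∉_; _∩_; ∣_∣)
open import Data.Vec using (tabulate)
open import Data.Bool using (Bool)
open import Relation.Nullary using (¬_; Dec; does)
open import Relation.Binary.PropositionalEquality using (_≡_)
open import Data.Empty using (⊥)
open import Data.Sum using (_⊎_)

record Graph (n : ℕ) : Set₁ where
  field
    Adj     : Fin n → Fin n → Set
    adj?    : (u v : Fin n) → Dec (Adj u v)
    sym     : ∀ {u v} → Adj u v → Adj v u
    irrefl  : ∀ {u} → ¬ Adj u u

module _ {n : ℕ} (G : Graph n) where
  open Graph G

  N : Fin n → Subset n
  N v = tabulate (λ u → does (adj? v u))

  deg : Fin n → ℕ
  deg v = ∣ N v ∣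

  degIn : Subset n → Fin n → ℕ
  degIn D v = ∣ N v ∩ D ∣

  MinDegAtLeast : ℕ → Set
  MinDegAtLeast k = ∀ v → k ≤ deg v

  IsKTupleDom : ℕ → Subset n → Set
  IsKTupleDom k D =
    (∀ v → v ∉ D → k ≤ degIn D v) × (∀ v → v ∈ D → k ∸ 1 ≤ degIn D v)
    where open import Data.Product using (_×_)

  -- D has minimum cardinality among k-tuple dominating sets, i.e. |D| = γ×k(G)
  IsMinKTupleDom : ℕ → Subset n → Set
  IsMinKTupleDom k D =
    IsKTupleDom k D × (∀ D' → IsKTupleDom k D' → ∣ D ∣ ≤ ∣ D' ∣)
    where open import Data.Product using (_×_)

  DisjointClosedNbhd : Fin n → Fin n → Set
  DisjointClosedNbhd u v =
    ∀ w → (w ≡ u ⊎ Adj u w) → (w ≡ v ⊎ Adj v w) → ⊥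

  Is2Packing : Subset n → Set
  Is2Packing P = ∀ u v → u ∈ P → v ∈ P → ¬ (u ≡ v) → DisjointClosedNbhd u v

  -- P is a maximum 2-packing, i.e. |P| = ρ(G)
  IsMax2Packing : Subset n → Set
  IsMax2Packing P =
    Is2Packing P × (∀ P' → Is2Packing P' → ∣ P' ∣ ≤ ∣ P ∣)
    where open import Data.Product using (_×_)

{-# OPTIONS --safe #-}
-- For a 2-packing P the closed neighbourhoods N[q], q ∈ P, are pairwise disjoint, and each
-- meets a k-tuple dominating set D in at least k vertices; double counting gives k|P| ≤ |D|.
-- Conversely V ∖ P is k-tuple dominating: a vertex of P has all its neighbours outside P,
-- and every vertex has at most one neighbour in P, so δ(G) ≥ k gives the required degrees.
module Submission where

open import Defs
open import Data.Nat using (ℕ; zero; suc; _+_; _≤_; _*_; _∸_; z≤n; s≤s)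
open import Data.Nat.Properties
  using (+-*-semiring; +-suc; *-identityʳ; *-zeroʳ; ≤-reflexive; ≤-trans; +-mono-≤; +-monoˡ-≤; ∸-monoˡ-≤; m≤n+m∸n; module ≤-Reasoning)
open import Data.Bool using (Bool; true; false; if_then_else_)
open import Data.Fin using (Fin; zero; suc)
open import Data.Fin.Properties using (_≟_)
open import Data.Fin.Subset using (Subset; _∈_; _∉_; _∩_; _∪_; _⊆_; _⊂_; ∁; ⁅_⁆; ⊥; Empty; ∣_∣)
open import Data.Fin.Subset.Properties
  using (_∈?_; nonempty?; Empty-unique; ∉⊥; ∣⊥∣≡0; x∈⁅x⁆; x∈⁅y⁆⇒x≡y; ∣⁅x⁆∣≡1; p⊆q⇒∣p∣≤∣q∣; p⊂q⇒∣p∣<∣q∣;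
         x∈p∩q⁺; x∈p∩q⁻; x∈p∪q⁺; x∈p∪q⁻; q⊆p∪q; x∉p⇒x∈∁p; x∉∁p⇒x∈p; ∣∁p∣≡n∸∣p∣)
open import Data.Vec using ([]; _∷_; lookup; tabulate)
open import Data.Vec.Properties using (lookup∘tabulate; tabulate∘lookup; []=⇒lookup; lookup⇒[]=)
open import Data.Vec.Functional using (Vector)
open import Data.Product using (_×_; _,_; proj₁; proj₂)
open import Data.Sum using (_⊎_; inj₁; inj₂)
open import Data.Empty using (⊥-elim)
open import Function using (_∘_)
open import Relation.Nullary using (yes; no; contradiction)
open import Relation.Nullary.Decidable using (dec-true)
open import Relation.Binary.PropositionalEquality using (_≡_; _≢_; refl; sym; trans; cong; subst)
open import Algebra.Properties.Semiring.Sum +-*-semiring using (sum; sum-syntax; sum-cong-≗; ∑-comm; *-distribˡ-sum)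

𝟙 : Bool → ℕ
𝟙 true  = 1
𝟙 false = 0

sum-mono-≤ : ∀ {n} {f g : Vector ℕ n} → (∀ i → f i ≤ g i) → sum f ≤ sum g
sum-mono-≤ {zero}  f≤g = z≤n
sum-mono-≤ {suc n} f≤g = +-mono-≤ (f≤g zero) (sum-mono-≤ (f≤g ∘ suc))

∣tabulate∣≡∑ : ∀ {n} (f : Fin n → Bool) → ∣ tabulate f ∣ ≡ ∑[ i < n ] 𝟙 (f i)
∣tabulate∣≡∑ {zero}  f = refl
∣tabulate∣≡∑ {suc n} f with f zero
... | true  = cong suc (∣tabulate∣≡∑ (f ∘ suc))
... | false = ∣tabulate∣≡∑ (f ∘ suc)

∣p∣≡∑ : ∀ {n} (p : Subset n) → ∣ p ∣ ≡ ∑[ i < n ] 𝟙 (lookup p i)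
∣p∣≡∑ p = trans (cong ∣_∣ (sym (tabulate∘lookup p))) (∣tabulate∣≡∑ (lookup p))

∈tabulate⁻ : ∀ {n} {f : Fin n → Bool} {i} → i ∈ tabulate f → f i ≡ true
∈tabulate⁻ {f = f} {i} i∈ = trans (sym (lookup∘tabulate f i)) ([]=⇒lookup i∈)

∣p∣≡∣p∩q∣+∣p∩∁q∣ : ∀ {n} (p q : Subset n) → ∣ p ∣ ≡ ∣ p ∩ q ∣ + ∣ p ∩ ∁ q ∣
∣p∣≡∣p∩q∣+∣p∩∁q∣ []          []          = refl
∣p∣≡∣p∩q∣+∣p∩∁q∣ (false ∷ p) (_     ∷ q) = ∣p∣≡∣p∩q∣+∣p∩∁q∣ p q
∣p∣≡∣p∩q∣+∣p∩∁q∣ (true  ∷ p) (true  ∷ q) = cong suc (∣p∣≡∣p∩q∣+∣p∩∁q∣ p q)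
∣p∣≡∣p∩q∣+∣p∩∁q∣ (true  ∷ p) (false ∷ q) =
  trans (cong suc (∣p∣≡∣p∩q∣+∣p∩∁q∣ p q)) (sym (+-suc ∣ p ∩ q ∣ ∣ p ∩ ∁ q ∣))

Empty⇒∣p∣≡0 : ∀ {n} {p : Subset n} → Empty p → ∣ p ∣ ≡ 0
Empty⇒∣p∣≡0 {n} p-empty = trans (cong ∣_∣ (Empty-unique p-empty)) (∣⊥∣≡0 n)

subsingleton⇒∣p∣≤1 : ∀ {n} {p : Subset n} → (∀ {x y} → x ∈ p → y ∈ p → x ≡ y) → ∣ p ∣ ≤ 1
subsingleton⇒∣p∣≤1 {p = p} unique with nonempty? p
... | no  p-empty   = ≤-trans (≤-reflexive (Empty⇒∣p∣≡0 p-empty)) z≤n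
... | yes (x , x∈p) = ≤-trans (p⊆q⇒∣p∣≤∣q∣ p⊆⁅x⁆) (≤-reflexive (∣⁅x⁆∣≡1 x))
  where
  p⊆⁅x⁆ : p ⊆ ⁅ x ⁆
  p⊆⁅x⁆ y∈p = subst (_∈ ⁅ x ⁆) (unique x∈p y∈p) (x∈⁅x⁆ x)

∑∣Cq∩D∣≤∣D∣ : ∀ {m n} (C : Fin m → Subset n) (D : Subset n) →
  (∀ {q q′ w} → w ∈ C q → w ∈ C q′ → q ≡ q′) →
  ∑[ q < m ] ∣ C q ∩ D ∣ ≤ ∣ D ∣
∑∣Cq∩D∣≤∣D∣ {m} {n} C D disjoint = begin
  ∑[ q < m ] ∣ C q ∩ D ∣                        ≡⟨ sum-cong-≗ (λ q → ∣p∣≡∑ (C q ∩ D)) ⟩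
  ∑[ q < m ] ∑[ w < n ] 𝟙 (lookup (C q ∩ D) w)  ≡⟨ ∑-comm (λ q w → 𝟙 (lookup (C q ∩ D) w)) ⟩
  ∑[ w < n ] ∑[ q < m ] 𝟙 (lookup (C q ∩ D) w)  ≡⟨ sum-cong-≗ (λ w → sym (∣tabulate∣≡∑ (λ q → lookup (C q ∩ D) w))) ⟩
  ∑[ w < n ] ∣ column w ∣                       ≤⟨ sum-mono-≤ ∣column∣≤𝟙 ⟩
  ∑[ w < n ] 𝟙 (lookup D w)                     ≡⟨ sym (∣p∣≡∑ D) ⟩
  ∣ D ∣                                         ∎
  where
  open ≤-Reasoning
  column : Fin n → Subset m
  column w = tabulate (λ q → lookup (C q ∩ D) w)

  ∈column⁻ : ∀ {w q} → q ∈ column w → w ∈ C q × w ∈ D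
  ∈column⁻ {w} {q} q∈ = x∈p∩q⁻ (C q) D (lookup⇒[]= w (C q ∩ D) (∈tabulate⁻ q∈))

  ∣column∣≤𝟙 : ∀ w → ∣ column w ∣ ≤ 𝟙 (lookup D w)
  ∣column∣≤𝟙 w with lookup D w in w∈?D
  ... | true  = subsingleton⇒∣p∣≤1 (λ q∈ q′∈ → disjoint (proj₁ (∈column⁻ q∈)) (proj₁ (∈column⁻ q′∈)))
  ... | false = ≤-reflexive (Empty⇒∣p∣≡0 column-empty)
    where
    column-empty : Empty (column w)
    column-empty (q , q∈) = contradiction (trans (sym w∈?D) ([]=⇒lookup (proj₂ (∈column⁻ q∈)))) λ ()

module _ {n : ℕ} (G : Graph n) where
  open Graph G renaming (sym to Adj-sym)

  N[_] : Fin n → Subset n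
  N[ v ] = ⁅ v ⁆ ∪ N G v

  ∈N⁺ : ∀ {v w} → Adj v w → w ∈ N G v
  ∈N⁺ {v} {w} v~w = lookup⇒[]= w (N G v) (trans (lookup∘tabulate _ w) (dec-true (adj? v w) v~w))

  ∈N⁻ : ∀ {v w} → w ∈ N G v → Adj v w
  ∈N⁻ {v} {w} w∈ with adj? v w | ∈tabulate⁻ w∈
  ... | yes v~w | _ = v~w
  ... | no  _   | ()

  ∈N[]⁻ : ∀ {v w} → w ∈ N[ v ] → w ≡ v ⊎ Adj v w
  ∈N[]⁻ {v} w∈ with x∈p∪q⁻ ⁅ v ⁆ (N G v) w∈
  ... | inj₁ w∈⁅v⁆ = inj₁ (x∈⁅y⁆⇒x≡y v w∈⁅v⁆)
  ... | inj₂ w∈N   = inj₂ (∈N⁻ w∈N)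

  N⊆N[] : ∀ {v} → N G v ⊆ N[ v ]
  N⊆N[] {v} = q⊆p∪q ⁅ v ⁆ (N G v)

  N∩D⊆N[]∩D : ∀ {v D} → N G v ∩ D ⊆ N[ v ] ∩ D
  N∩D⊆N[]∩D {v} {D} w∈ = let (w∈N , w∈D) = x∈p∩q⁻ (N G v) D w∈ in x∈p∩q⁺ (N⊆N[] w∈N , w∈D)

  N∩D⊂N[]∩D : ∀ {v D} → v ∈ D → N G v ∩ D ⊂ N[ v ] ∩ D
  N∩D⊂N[]∩D {v} {D} v∈D = N∩D⊆N[]∩D , v , x∈p∩q⁺ (x∈p∪q⁺ (inj₁ (x∈⁅x⁆ v)) , v∈D) , v∉N∩D
    where
    v∉N∩D : v ∉ N G v ∩ D
    v∉N∩D v∈ = irrefl (∈N⁻ (proj₁ (x∈p∩q⁻ (N G v) D v∈)))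

  kTupleDom⇒k≤∣N[]∩D∣ : ∀ {k D} → IsKTupleDom G k D → ∀ v → k ≤ ∣ N[ v ] ∩ D ∣
  kTupleDom⇒k≤∣N[]∩D∣ {k} {D} (outside-bound , inside-bound) v with v ∈? D
  ... | yes v∈D = ≤-trans (m≤n+m∸n k 1) (≤-trans (s≤s (inside-bound v v∈D)) (p⊂q⇒∣p∣<∣q∣ (N∩D⊂N[]∩D v∈D)))
  ... | no  v∉D = ≤-trans (outside-bound v v∉D) (p⊆q⇒∣p∣≤∣q∣ N∩D⊆N[]∩D)

  2Packing⇒N[]-disjoint : ∀ {P q q′ w} → Is2Packing G P → q ∈ P → q′ ∈ P →
    w ∈ N[ q ] → w ∈ N[ q′ ] → q ≡ q′
  2Packing⇒N[]-disjoint {q = q} {q′} {w} packing q∈P q′∈P w∈ w∈′ with q ≟ q′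
  ... | yes q≡q′ = q≡q′
  ... | no  q≢q′ = ⊥-elim (packing q q′ q∈P q′∈P q≢q′ w (∈N[]⁻ w∈) (∈N[]⁻ w∈′))

  k*∣P∣≤∣D∣ : ∀ {k D P} → IsKTupleDom G k D → Is2Packing G P → k * ∣ P ∣ ≤ ∣ D ∣
  k*∣P∣≤∣D∣ {k} {D} {P} dom packing = begin
    k * ∣ P ∣                      ≡⟨ cong (k *_) (∣p∣≡∑ P) ⟩
    k * (∑[ q < n ] 𝟙 (lookup P q)) ≡⟨ *-distribˡ-sum k (𝟙 ∘ lookup P) ⟩
    ∑[ q < n ] (k * 𝟙 (lookup P q)) ≤⟨ sum-mono-≤ k*𝟙[q∈P]≤∣Cq∩D∣ ⟩
    ∑[ q < n ] ∣ C q ∩ D ∣          ≤⟨ ∑∣Cq∩D∣≤∣D∣ C D C-disjoint ⟩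
    ∣ D ∣                          ∎
    where
    open ≤-Reasoning
    -- Restricting N[_] to P lets the sum over P run over all vertices.
    C : Fin n → Subset n
    C q = if lookup P q then N[ q ] else ⊥

    k*𝟙[q∈P]≤∣Cq∩D∣ : ∀ q → k * 𝟙 (lookup P q) ≤ ∣ (if lookup P q then N[ q ] else ⊥) ∩ D ∣
    k*𝟙[q∈P]≤∣Cq∩D∣ q with lookup P q
    ... | true  = ≤-trans (≤-reflexive (*-identityʳ k)) (kTupleDom⇒k≤∣N[]∩D∣ dom q)
    ... | false = ≤-trans (≤-reflexive (*-zeroʳ k)) z≤n

    C-disjoint : ∀ {q q′ w} →
      w ∈ (if lookup P q then N[ q ] else ⊥) → w ∈ (if lookup P q′ then N[ q′ ] else ⊥) → q ≡ q′
    C-disjoint {q} {q′} with lookup P q in q∈?P | lookup P q′ in q′∈?P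
    ... | false | _     = λ w∈⊥ _ → contradiction w∈⊥ ∉⊥
    ... | true  | false = λ _ w∈⊥ → contradiction w∈⊥ ∉⊥
    ... | true  | true  = 2Packing⇒N[]-disjoint packing (lookup⇒[]= q P q∈?P) (lookup⇒[]= q′ P q′∈?P)

  2Packing⇒N⊆∁P : ∀ {P v} → Is2Packing G P → v ∈ P → N G v ⊆ ∁ P
  2Packing⇒N⊆∁P {v = v} packing v∈P {w} w∈N =
    x∉p⇒x∈∁p (λ w∈P → packing v w v∈P w∈P v≢w w (inj₂ v~w) (inj₁ refl))
    where
    v~w : Adj v w
    v~w = ∈N⁻ w∈N
    v≢w : v ≢ w
    v≢w refl = irrefl v~w

  2Packing⇒∣N∩P∣≤1 : ∀ {P} → Is2Packing G P → ∀ v → ∣ N G v ∩ P ∣ ≤ 1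
  2Packing⇒∣N∩P∣≤1 {P} packing v = subsingleton⇒∣p∣≤1 λ w∈ w′∈ →
    2Packing⇒N[]-disjoint packing (proj₂ (x∈p∩q⁻ (N G v) P w∈)) (proj₂ (x∈p∩q⁻ (N G v) P w′∈))
      (v∈N[w] w∈) (v∈N[w] w′∈)
    where
    v∈N[w] : ∀ {w} → w ∈ N G v ∩ P → v ∈ N[ w ]
    v∈N[w] w∈ = N⊆N[] (∈N⁺ (Adj-sym (∈N⁻ (proj₁ (x∈p∩q⁻ (N G v) P w∈)))))

  2Packing⇒∁-kTupleDom : ∀ {k P} → MinDegAtLeast G k → Is2Packing G P → IsKTupleDom G k (∁ P)
  2Packing⇒∁-kTupleDom {k} {P} δ≥k packing = outside-bound , inside-bound
    where
    outside-bound : ∀ v → v ∉ ∁ P → k ≤ degIn G (∁ P) v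
    outside-bound v v∉∁P = ≤-trans (δ≥k v) (p⊆q⇒∣p∣≤∣q∣ N⊆N∩∁P)
      where
      N⊆N∩∁P : N G v ⊆ N G v ∩ ∁ P
      N⊆N∩∁P w∈N = x∈p∩q⁺ (w∈N , 2Packing⇒N⊆∁P packing (x∉∁p⇒x∈p v∉∁P) w∈N)

    inside-bound : ∀ v → v ∈ ∁ P → k ∸ 1 ≤ degIn G (∁ P) v
    inside-bound v _ = ∸-monoˡ-≤ 1 (begin
      k                                 ≤⟨ δ≥k v ⟩
      deg G v                           ≡⟨ ∣p∣≡∣p∩q∣+∣p∩∁q∣ (N G v) P ⟩
      ∣ N G v ∩ P ∣ + degIn G (∁ P) v   ≤⟨ +-monoˡ-≤ (degIn G (∁ P) v) (2Packing⇒∣N∩P∣≤1 packing v) ⟩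
      suc (degIn G (∁ P) v)             ∎)
      where open ≤-Reasoning

theorem2 : (k n : ℕ) → 2 ≤ k → (G : Graph n) → MinDegAtLeast G k →
    (D P : Subset n) → IsMinKTupleDom G k D → IsMax2Packing G P →
    (k * ∣ P ∣ ≤ ∣ D ∣) × (∣ D ∣ ≤ n ∸ ∣ P ∣)
theorem2 k n _ G δ≥k D P (D-dom , D-min) (P-packing , _) =
  k*∣P∣≤∣D∣ G D-dom P-packing ,
  ≤-trans (D-min (∁ P) (2Packing⇒∁-kTupleDom G δ≥k P-packing)) (≤-reflexive (∣∁p∣≡n∸∣p∣ P))
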